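{- Let $A\in\mathcal C$, let $U$ and $V$ be independent subsets of $A$ and of $T$ respectively, and let $f:{\rm desc}(U)\to{\rm desc}(V)$ be an isomorphism. Let $Q$ be the set of $q$-element subsets $p\subseteq U$ such that $p$ has a common predecessor in $A$ and $f(p)$ has a common predecessor in $T$. For each $p\in Q$ choose a common predecessor $w_p$ of $p$ in $A$ and let $w_{f(p)}$ be a common predecessor of $f(p)$ in $T$. Put $U'=(U\setminus\bigcup Q)\cup\{w_p: p\in Q\}$ and $V'=(V\setminus\bigcup_{p\in Q} f(p))\cup\{w_{f(p)}:p\in Q\}$. Then: (a) $U'$ and $V'$ are independent subsets of $A$ and $T$ respectively, and the extension $F$ of $f$ which maps $w_p$ to $w_{f(p)}$ for each $p\in Q$ is an isomorphism from ${\rm desc}(U')$ to ${\rm desc}(V')$; (b) if $I\subseteq A$ is disjoint from $U$ and $U\cup I$ is an independent subset of $A$, then $U'\cup I$ is also independent.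
   Context: For $s\ge0$ an $s$-arc from $u_0$ to $u_s$ is a sequence $u_0\ldots u_s$ with $(u_i,u_{i+1})$ edges and $u_{i-1}\ne u_{i+1}$ for $0<i<s$; ${\rm desc}(u)$ is the set of vertices reachable from $u$ by an $s$-arc for some $s\ge0$, ${\rm desc}(X)=\bigcup_{x\in X}{\rm desc}(x)$, regarded as induced subdigraphs. A subset is independent if the descendant sets of any two distinct members are disjoint. A common predecessor of a set $X$ of vertices is a vertex $a$ such that $(a,x)$ is an edge for all $x\in X$. A subset $S$ is finitely generated if $S={\rm desc}(F)$ for a finite $F$. Fix an integer $q\ge2$; $T$ is the $q$-valent rooted tree (vertices: finite sequences over $\{0,\ldots,q-1\}$; edges $(\bar w,\bar wi)$). $\mathcal C$ is the class of digraphs $A$ such that ${\rm desc}(a)\cong T$ for all $a\in A$, $A$ is finitely generated, and ${\rm desc}(a)\cap{\rm desc}(b)$ is finitely generated for all $a,b\in A$. -}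

module Defs where

open import Data.Nat using (ℕ; _≤_)
open import Data.Fin using (Fin)
open import Data.List using (List; []; _∷_; _∷ʳ_)
open import Data.List.Membership.Propositional using (_∈_)
open import Data.Product using (Σ; ∃; ∃-syntax; _×_; _,_)
open import Data.Sum using (_⊎_)
open import Data.Unit using (⊤)
open import Relation.Nullary using (¬_)
open import Relation.Binary.PropositionalEquality using (_≡_; _≢_)
open import Function using (_∘_)
open import Function.Definitions using (Injective)

record Digraph : Set₁ where
  field
    Carrier : Set
    Edge    : Carrier → Carrier → Set
open Digraph public

Subset : Digraph → Set₁
Subset G = Carrier G → Set

-- s-arcs.  An s-arc u₀ u₁ … u_s is encoded as its first vertex u₀ together
-- with the list [u₁, …, u_s].  IsArc G u₀ l says consecutive vertices are
-- joined by edges and u_{i-1} ≢ u_{i+1}.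

IsArc : (G : Digraph) → Carrier G → List (Carrier G) → Set
IsArc G u []            = ⊤
IsArc G u (v ∷ [])      = Edge G u v
IsArc G u (v ∷ w ∷ ws)  = Edge G u v × (u ≢ w) × IsArc G v (w ∷ ws)

endpoint : {X : Set} → X → List X → X
endpoint u []       = u
endpoint u (v ∷ vs) = endpoint v vs

Desc : (G : Digraph) → Carrier G → Carrier G → Set
Desc G u x = Σ (List (Carrier G)) λ l → IsArc G u l × endpoint u l ≡ x

DescSet : (G : Digraph) → Subset G → Subset G
DescSet G X x = ∃[ a ] (X a × Desc G a x)

Independent : (G : Digraph) → Subset G → Set
Independent G S = ∀ a b → S a → S b → a ≢ b →
                  ∀ x → ¬ (Desc G a x × Desc G b x)

CommonPred : (G : Digraph) {n : ℕ} → Carrier G → (Fin n → Carrier G) → Set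
CommonPred G a e = ∀ i → Edge G a (e i)

-- Isomorphisms between induced subdigraphs G[S] and H[S'], given by a
-- relation R ⊆ G × H (the graph of the map): R restricted to S is the
-- graph of a bijection S → S' that preserves and reflects edges.

record IsIsoRel (G H : Digraph) (S : Subset G) (S' : Subset H)
                (R : Carrier G → Carrier H → Set) : Set where
  field
    total      : ∀ x → S x → ∃[ y ] R x y
    into       : ∀ x y → S x → R x y → S' y
    functional : ∀ x y y' → S x → R x y → R x y' → y ≡ y'
    injective  : ∀ x x' y → S x → S x' → R x y → R x' y → x ≡ x'
    surjective : ∀ y → S' y → ∃[ x ] (S x × R x y)
    edge→      : ∀ x x' y y' → S x → S x' → R x y → R x' y' →
                 Edge G x x' → Edge H y y'
    edge←      : ∀ x x' y y' → S x → S x' → R x y → R x' y' →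
                 Edge H y y' → Edge G x x'

Graph : {X Y : Set} → (X → Y) → X → Y → Set
Graph f x y = f x ≡ y

Full : (G : Digraph) → Subset G
Full G x = ⊤

-- The q-valent rooted tree T: finite sequences over {0,…,q-1},
-- edges (w̄, w̄ i).

T : ℕ → Digraph
T q = record { Carrier = List (Fin q) ; Edge = λ u v → ∃[ i ] (v ≡ u ∷ʳ i) }

FinGen : (G : Digraph) → Subset G → Set
FinGen G S = ∃[ F ] (∀ x → (S x → DescSet G (_∈ F) x) × (DescSet G (_∈ F) x → S x))

record InC (q : ℕ) (A : Digraph) : Set where
  field
    descTree : ∀ a → ∃[ φ ] IsIsoRel A (T q) (Desc A a) (Full (T q)) (Graph φ)
    finGen   : FinGen A (Full A)
    capFinGen : ∀ a b → FinGen A (λ x → Desc A a x × Desc A b x)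

-- Data of the lemma.  A q-element subset p ⊆ U is represented by an
-- injective enumeration e : Fin q → A.

SameImage : {X : Set} {n : ℕ} → (Fin n → X) → (Fin n → X) → Set
SameImage e e' = ∀ x → ((∃[ i ] (e i ≡ x)) → ∃[ i ] (e' i ≡ x))
                     × ((∃[ i ] (e' i ≡ x)) → ∃[ i ] (e i ≡ x))

module Lemma (q : ℕ) (A : Digraph) (U : Subset A)
             (f : Carrier A → List (Fin q))
             (w : (Fin q → Carrier A) → Carrier A)
             (wT : (Fin q → List (Fin q)) → List (Fin q)) where

  InQ : (Fin q → Carrier A) → Set
  InQ e = Injective _≡_ _≡_ e × (∀ i → U (e i))
        × (∃[ a ] CommonPred A a e) × (∃[ b ] CommonPred (T q) b (f ∘ e))

  U' : Subset A
  U' x = (U x × ¬ (∃[ e ] (InQ e × ∃[ i ] (e i ≡ x))))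
       ⊎ (∃[ e ] (InQ e × w e ≡ x))

  V' : Subset (T q) → Subset (T q)
  V' V y = (V y × ¬ (∃[ e ] (InQ e × ∃[ i ] (f (e i) ≡ y))))
         ⊎ (∃[ e ] (InQ e × wT (f ∘ e) ≡ y))

  Fext : Carrier A → List (Fin q) → Set
  Fext x y = (DescSet A U x × f x ≡ y)
           ⊎ (∃[ e ] (InQ e × w e ≡ x × wT (f ∘ e) ≡ y))

_∪_ : {X : Set} → (X → Set) → (X → Set) → X → Set
(S ∪ S') x = S x ⊎ S' x

-- Every descendant set in A is a copy of T, so A has no 2-cycles below any vertex and
-- non-backtracking arcs compose; descendant sets are therefore closed and no edge leads back
-- to an ancestor.  Since w_p has q children and its q members p are
-- among them, the children of w_p are exactly p, and likewise for w_{f(p)} and f(p) in T.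
-- Hence desc(w_p) = {w_p} ∪ desc(p), w_p ∉ desc(U) (an edge w_p → p would close a cycle
-- or violate independence), and two members of Q sharing a vertex have the same common
-- predecessor.  Replacing each such p by w_p therefore keeps a set independent; this gives
-- U', V' and, applied to U ∪ I, part (b).  The map F is f on desc(U) and w_p ↦ w_{f(p)},
-- and it preserves and reflects edges because the only new edges are w_p → p.
module Submission where

open import Defs
open import Data.Nat using (ℕ; zero; suc; _≤_; s≤s; z≤n)
import Data.Nat.Properties as ℕₚ
open import Data.Fin using (Fin; fromℕ<; punchOut)
import Data.Fin as Fin
import Data.Fin.Properties as Finₚ
open import Data.List using (List; []; _∷_; _∷ʳ_; _++_; length)
import Data.List.Properties as Listₚ
open import Data.Product using (∃₂; ∃-syntax; _×_; _,_; proj₁; proj₂)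
open import Data.Sum using (_⊎_; inj₁; inj₂)
open import Data.Unit using (tt)
open import Data.Empty using (⊥; ⊥-elim)
open import Relation.Nullary using (¬_; yes; no)
open import Relation.Nullary.Decidable using (decidable-stable)
open import Relation.Binary.PropositionalEquality
  using (_≡_; _≢_; refl; sym; trans; cong; subst)
open import Function using (_∘_)
open import Function.Definitions using (Injective)

Fin-injective⇒surjective : ∀ {n} (g : Fin n → Fin n) → Injective _≡_ _≡_ g →
                           ∀ k → ∃[ i ] (g i ≡ k)
Fin-injective⇒surjective {zero}  g g-inj ()
Fin-injective⇒surjective {suc n} g g-inj k with Finₚ.any? (λ i → g i Finₚ.≟ k)
... | yes hit = hit
... | no miss = ⊥-elim (no-collision (Finₚ.pigeonhole (ℕₚ.n<1+n n) g-avoiding-k))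
  where
  g-avoiding-k : Fin (suc n) → Fin n
  g-avoiding-k i = punchOut {i = k} {j = g i} (λ k≡gi → miss (i , sym k≡gi))
  no-collision : ∃₂ (λ i j → i Fin.< j × g-avoiding-k i ≡ g-avoiding-k j) → ⊥
  no-collision (i , j , i<j , eq) =
    Finₚ.<-irrefl (g-inj (Finₚ.punchOut-injective {i = k} _ _ eq)) i<j

Independent-antitone : ∀ {G} {S S' : Subset G} → (∀ {x} → S x → S' x) →
                       Independent G S' → Independent G S
Independent-antitone S⊆S' S'-ind a b Sa Sb = S'-ind a b (S⊆S' Sa) (S⊆S' Sb)

module Arcs (G : Digraph) where
  private
    X : Set
    X = Carrier G

  penultimate : X → List X → X
  penultimate u []           = u
  penultimate u (v ∷ [])     = u
  penultimate u (v ∷ w ∷ ws) = penultimate v (w ∷ ws)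

  dropLast : List X → List X
  dropLast []           = []
  dropLast (v ∷ [])     = []
  dropLast (v ∷ w ∷ ws) = v ∷ dropLast (w ∷ ws)

  IsArc-dropLast : ∀ u l → IsArc G u l → IsArc G u (dropLast l)
  IsArc-dropLast u []               _              = tt
  IsArc-dropLast u (v ∷ [])         _              = tt
  IsArc-dropLast u (v ∷ w ∷ [])     (e , _ , _)    = e
  IsArc-dropLast u (v ∷ w ∷ x ∷ xs) (e , u≢w , vs) = e , u≢w , IsArc-dropLast v (w ∷ x ∷ xs) vs

  endpoint-dropLast : ∀ u l → endpoint u (dropLast l) ≡ penultimate u l
  endpoint-dropLast u []           = refl
  endpoint-dropLast u (v ∷ [])     = refl
  endpoint-dropLast u (v ∷ w ∷ ws) = endpoint-dropLast v (w ∷ ws)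

  penultimate-edge : ∀ u v l → IsArc G u (v ∷ l) →
                     Edge G (penultimate u (v ∷ l)) (endpoint u (v ∷ l))
  penultimate-edge u v []       e            = e
  penultimate-edge u v (w ∷ ws) (_ , _ , vs) = penultimate-edge v w ws vs

  IsArc-∷ʳ : ∀ u v l y → IsArc G u (v ∷ l) → Edge G (endpoint u (v ∷ l)) y →
             penultimate u (v ∷ l) ≢ y → IsArc G u (v ∷ (l ∷ʳ y))
  IsArc-∷ʳ u v []       y e            e' p≢y = e , p≢y , e'
  IsArc-∷ʳ u v (w ∷ ws) y (e , u≢w , vs) e' p≢y = e , u≢w , IsArc-∷ʳ v w ws y vs e' p≢y

  endpoint-∷ʳ : ∀ (u : X) l y → endpoint u (l ∷ʳ y) ≡ y
  endpoint-∷ʳ u []      y = refl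
  endpoint-∷ʳ u (v ∷ l) y = endpoint-∷ʳ v l y

  IsArc-head : ∀ u v l → IsArc G u (v ∷ l) → Edge G u v
  IsArc-head u v []       e           = e
  IsArc-head u v (w ∷ ws) (e , _ , _) = e

  IsArc-tail : ∀ u v l → IsArc G u (v ∷ l) → IsArc G v l
  IsArc-tail u v []       _            = tt
  IsArc-tail u v (w ∷ ws) (_ , _ , vs) = vs

  Desc-refl : ∀ u → Desc G u u
  Desc-refl u = [] , tt , refl

  Edge⇒Desc : ∀ {u v} → Edge G u v → Desc G u v
  Edge⇒Desc {v = v} e = v ∷ [] , e , refl

  Desc-uncons : ∀ {u x} → Desc G u x → x ≡ u ⊎ ∃[ v ] (Edge G u v × Desc G v x)
  Desc-uncons         ([] , _ , refl)    = inj₁ refl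
  Desc-uncons {u} (v ∷ l , arc , eq) =
    inj₂ (v , IsArc-head u v l arc , l , IsArc-tail u v l arc , eq)

  Desc-below : ∀ {n r x} (e : Fin n → X) → (∀ v → Edge G r v → ∃[ i ] (e i ≡ v)) →
               Desc G r x → x ≡ r ⊎ ∃[ i ] Desc G (e i) x
  Desc-below e children d with Desc-uncons d
  ... | inj₁ x≡r = inj₁ x≡r
  ... | inj₂ (v , r→v , v→x) with children v r→v
  ...   | i , refl = inj₂ (i , v→x)

  NoTwoCycleBelow : X → Set
  NoTwoCycleBelow a = ∀ x y → Desc G a x → Desc G a y → Edge G x y → Edge G y x → ⊥

  DescStep : Set
  DescStep = ∀ {a x y} → Desc G a x → Edge G x y → Desc G a y

  -- Appending y to an arc ending in x can only backtrack through a 2-cycle x ⇄ y below a.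
  Desc-∷ʳ : ∀ {a x y} → NoTwoCycleBelow a → Desc G a x → Edge G x y → Desc G a y
  Desc-∷ʳ noCycle ([] , _ , refl) e = Edge⇒Desc e
  Desc-∷ʳ {a} {y = y} noCycle (v ∷ l , arc , refl) e =
    v ∷ (l ∷ʳ y) , IsArc-∷ʳ a v l y arc e p≢y , endpoint-∷ʳ v l y
    where
    p : X
    p = penultimate a (v ∷ l)
    p≢y : p ≢ y
    p≢y refl = noCycle p (endpoint a (v ∷ l))
                 (dropLast (v ∷ l) , IsArc-dropLast a (v ∷ l) arc , endpoint-dropLast a (v ∷ l))
                 (v ∷ l , arc , refl) (penultimate-edge a v l arc) e

  Desc-trans : DescStep → ∀ {a x y} → Desc G a x → Desc G x y → Desc G a y
  Desc-trans step {a} {x} {y} a→x (l , arc , eq) = go x l a→x arc eq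
    where
    go : ∀ x l → Desc G a x → IsArc G x l → endpoint x l ≡ y → Desc G a y
    go x []      a→x _   refl = a→x
    go x (v ∷ l) a→x arc eq   =
      go v l (step a→x (IsArc-head x v l arc)) (IsArc-tail x v l arc) eq

module _ {G H : Digraph} {S : Subset G} {S' : Subset H} {R : Carrier G → Carrier H → Set}
         (iso : IsIsoRel G H S S' R) where
  open IsIsoRel iso

  IsIsoRel-inverse : IsIsoRel H G S' S (λ y x → S x × R x y)
  IsIsoRel-inverse = record
    { total      = λ y S'y → surjective y S'y
    ; into       = λ _ _ _ r → proj₁ r
    ; functional = λ y x x' _ r r' → injective x x' y (proj₁ r) (proj₁ r') (proj₂ r) (proj₂ r')
    ; injective  = λ y y' x _ _ r r' → functional x y y' (proj₁ r) (proj₂ r) (proj₂ r')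
    ; surjective = λ x Sx → let (y , Rxy) = total x Sx in y , into x y Sx Rxy , Sx , Rxy
    ; edge→      = λ y y' x x' _ _ r r' →
                     edge← x x' y y' (proj₁ r) (proj₁ r') (proj₂ r) (proj₂ r')
    ; edge←      = λ y y' x x' _ _ r r' →
                     edge→ x x' y y' (proj₁ r) (proj₁ r') (proj₂ r) (proj₂ r')
    }

  Desc-transport : (∀ {s t} → S s → Desc G s t → S t) → Arcs.DescStep H →
                   ∀ {s y t} → S s → R s y → Desc G s t → ∃[ y' ] (R t y' × Desc H y y')
  Desc-transport S-closed stepH {s} {y} Ss Rsy (l , arc , eq) = go s y l Ss Rsy arc eq
    where
    go : ∀ s y l {t} → S s → R s y → IsArc G s l → endpoint s l ≡ t →
         ∃[ y' ] (R t y' × Desc H y y')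
    go s y []      Ss Rsy _   refl = y , Rsy , Arcs.Desc-refl H y
    go s y (v ∷ l) Ss Rsy arc eq
      with s→v ← Arcs.IsArc-head G s v l arc
      with Sv ← S-closed Ss (Arcs.Edge⇒Desc G s→v)
      with yv , Rvyv ← total v Sv
      with y' , Rty' , yv→y' ← go v yv l Sv Rvyv (Arcs.IsArc-tail G s v l arc) eq
      = y' , Rty' , Arcs.Desc-trans H stepH
                      (Arcs.Edge⇒Desc H (edge→ s v y yv Ss Sv Rsy Rvyv s→v)) yv→y'

module Tree (q : ℕ) where
  private
    TQ : Digraph
    TQ = T q
  open Arcs TQ using (Desc-refl; IsArc-head; IsArc-tail; NoTwoCycleBelow; DescStep; Desc-∷ʳ)

  Edge-length : ∀ {u v} → Edge TQ u v → length v ≡ suc (length u)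
  Edge-length {u} (i , refl) = trans (Listₚ.length-++ u) (ℕₚ.+-comm (length u) 1)

  Desc⇒prefix : ∀ {u x} → Desc TQ u x → ∃[ s ] (x ≡ u ++ s)
  Desc⇒prefix {u} (l , arc , eq) = go u l arc eq
    where
    go : ∀ u l {x} → IsArc TQ u l → endpoint u l ≡ x → ∃[ s ] (x ≡ u ++ s)
    go u []      _   refl = [] , sym (Listₚ.++-identityʳ u)
    go u (v ∷ l) arc eq with go v l (IsArc-tail u v l arc) eq | IsArc-head u v l arc
    ... | s , x≡v++s | i , refl = i ∷ s , trans x≡v++s (Listₚ.++-assoc u (i ∷ []) s)

  Desc⇒length-≤ : ∀ {u x} → Desc TQ u x → length u ≤ length x
  Desc⇒length-≤ {u} d with Desc⇒prefix d
  ... | s , refl = ℕₚ.≤-trans (ℕₚ.m≤m+n (length u) (length s))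
                              (ℕₚ.≤-reflexive (sym (Listₚ.length-++ u)))

  no-2-cycle : ∀ {x y} → Edge TQ x y → Edge TQ y x → ⊥
  no-2-cycle x→y y→x = ℕₚ.1+n≰n (ℕₚ.≤-trans (ℕₚ.n≤1+n _) (ℕₚ.≤-reflexive
    (trans (sym (cong suc (Edge-length x→y))) (sym (Edge-length y→x)))))

  Desc-step : DescStep
  Desc-step = Desc-∷ʳ (λ _ _ _ _ → no-2-cycle)

  Desc-antisym : ∀ {u x} → Desc TQ u x → Desc TQ x u → x ≡ u
  Desc-antisym {u} u→x x→u with Desc⇒prefix u→x
  ... | []    , x≡u++[] = trans x≡u++[] (Listₚ.++-identityʳ u)
  ... | c ∷ s , refl    = ⊥-elim (ℕₚ.m+1+n≰m (length u)
        (ℕₚ.≤-trans (ℕₚ.≤-reflexive (sym (Listₚ.length-++ u))) (Desc⇒length-≤ x→u)))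

  Edge-parent-unique : ∀ {b b' y} → Edge TQ b y → Edge TQ b' y → b ≡ b'
  Edge-parent-unique {b} {b'} (i , refl) (j , eq) = Listₚ.∷ʳ-injectiveˡ b b' eq

  no-edge-to-ancestor : ∀ {a x} → Desc TQ a x → Edge TQ x a → ⊥
  no-edge-to-ancestor a→x x→a =
    ℕₚ.1+n≰n (ℕₚ.≤-trans (ℕₚ.≤-reflexive (sym (Edge-length x→a))) (Desc⇒length-≤ a→x))

  -- The edges out of r carry pairwise distinct labels, and there are only q labels.
  children-of-common-pred : ∀ r (h : Fin q → List (Fin q)) → CommonPred TQ r h →
                            Injective _≡_ _≡_ h → ∀ y → Edge TQ r y → ∃[ i ] (h i ≡ y)
  children-of-common-pred r h r→h h-inj y (c , refl)
    with Fin-injective⇒surjective (proj₁ ∘ r→h) label-inj c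
    where
    label-inj : Injective _≡_ _≡_ (proj₁ ∘ r→h)
    label-inj {i} {j} eq =
      h-inj (trans (proj₂ (r→h i)) (trans (cong (r ∷ʳ_) eq) (sym (proj₂ (r→h j)))))
  ... | i , refl = i , proj₂ (r→h i)

-- With m e = e, r = w and S = U this is the paper's U'; with m e = f ∘ e, r e = wT (f ∘ e)
-- and S = V it is V'.
module Ascend (G : Digraph) (step : Arcs.DescStep G)
  (no-edge-to-ancestor : ∀ {a x} → Desc G a x → Edge G x a → ⊥)
  {Ix : Set} {n : ℕ} (P : Ix → Set) (m : Ix → Fin n → Carrier G) (r : Ix → Carrier G)
  (r→m : ∀ {e} → P e → ∀ i → Edge G (r e) (m e i))
  (children : ∀ {e} → P e → ∀ v → Edge G (r e) v → ∃[ i ] (m e i ≡ v))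
  (shared : ∀ {e e' i j} → P e → P e' → m e i ≡ m e' j → r e ≡ r e')
  (i₀ : Fin n) where
  open Arcs G using (Desc-refl; Desc-below)

  ascend : Subset G → Subset G
  ascend S x = (S x × ¬ (∃[ e ] (P e × ∃[ i ] (m e i ≡ x)))) ⊎ (∃[ e ] (P e × r e ≡ x))

  Desc-root : ∀ {e x} → P e → Desc G (r e) x → x ≡ r e ⊎ ∃[ i ] Desc G (m e i) x
  Desc-root {e} pe = Desc-below (m e) (children pe)

  root≡⇒shared : ∀ {e e'} → P e → P e' → r e ≡ r e' → ∃₂ λ i j → m e i ≡ m e' j
  root≡⇒shared {e} pe pe' re≡re'
    with children pe' (m e i₀) (subst (λ z → Edge G z (m e i₀)) re≡re' (r→m pe i₀))
  ... | j , eq = i₀ , j , sym eq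

  module _ {S : Subset G} (S-ind : Independent G S) (m∈S : ∀ {e} → P e → ∀ i → S (m e i)) where

    root∉descS : ∀ {e} → P e → ¬ DescSet G S (r e)
    root∉descS {e} pe (s , Ss , s→r) =
      S-ind s (m e i₀) Ss (m∈S pe i₀) s≢m (m e i₀) (step s→r (r→m pe i₀) , Desc-refl _)
      where
      s≢m : s ≢ m e i₀
      s≢m refl = no-edge-to-ancestor s→r (r→m pe i₀)

    descS-ascend : ∀ {x} → DescSet G (ascend S) x → DescSet G S x ⊎ ∃[ e ] (P e × r e ≡ x)
    descS-ascend (a , inj₁ (Sa , _) , a→x) = inj₁ (a , Sa , a→x)
    descS-ascend (a , inj₂ (e , pe , refl) , a→x) with Desc-root pe a→x
    ... | inj₁ refl         = inj₂ (e , pe , refl)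
    ... | inj₂ (i , mi→x)   = inj₁ (m e i , m∈S pe i , mi→x)

    kept-root-disjoint : ∀ {a e x} → S a → ¬ (∃[ e ] (P e × ∃[ i ] (m e i ≡ a))) → P e →
                         Desc G a x → Desc G (r e) x → ⊥
    kept-root-disjoint {a} {e} Sa a-kept pe a→x r→x with Desc-root pe r→x
    ... | inj₁ refl       = root∉descS pe (a , Sa , a→x)
    ... | inj₂ (i , mi→x) =
      S-ind a (m e i) Sa (m∈S pe i) (λ a≡mi → a-kept (e , pe , i , sym a≡mi)) _ (a→x , mi→x)

    ascend-independent : Independent G (ascend S)
    ascend-independent a b (inj₁ (Sa , _)) (inj₁ (Sb , _)) a≢b x = S-ind a b Sa Sb a≢b x
    ascend-independent a b (inj₁ (Sa , a-kept)) (inj₂ (e , pe , refl)) _ x (a→x , r→x) =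
      kept-root-disjoint Sa a-kept pe a→x r→x
    ascend-independent a b (inj₂ (e , pe , refl)) (inj₁ (Sb , b-kept)) _ x (r→x , b→x) =
      kept-root-disjoint Sb b-kept pe b→x r→x
    ascend-independent a b (inj₂ (e , pe , refl)) (inj₂ (e' , pe' , refl)) re≢re' x (r→x , r'→x)
      with Desc-root pe r→x | Desc-root pe' r'→x
    ... | inj₁ x≡r        | inj₁ x≡r'         = re≢re' (trans (sym x≡r) x≡r')
    ... | inj₁ refl       | inj₂ (j , m'j→x)  = root∉descS pe (m e' j , m∈S pe' j , m'j→x)
    ... | inj₂ (i , mi→x) | inj₁ refl         = root∉descS pe' (m e i , m∈S pe i , mi→x)
    ... | inj₂ (i , mi→x) | inj₂ (j , m'j→x)  =
      S-ind (m e i) (m e' j) (m∈S pe i) (m∈S pe' j) (re≢re' ∘ shared pe pe') x (mi→x , m'j→x)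

module Construction (q : ℕ) (2≤q : 2 ≤ q) (A : Digraph) (A∈𝒞 : InC q A)
  (U : Subset A) (V : Subset (T q)) (U-ind : Independent A U) (V-ind : Independent (T q) V)
  (f : Carrier A → List (Fin q))
  (f-iso : IsIsoRel A (T q) (DescSet A U) (DescSet (T q) V) (Graph f))
  (w : (Fin q → Carrier A) → Carrier A)
  (wT : (Fin q → List (Fin q)) → List (Fin q))
  (w-pred : ∀ e → Lemma.InQ q A U f w wT e → CommonPred A (w e) e)
  (w-image : ∀ e e' → Lemma.InQ q A U f w wT e → Lemma.InQ q A U f w wT e' →
             SameImage e e' → w e ≡ w e')
  (wT-pred : ∀ e → Lemma.InQ q A U f w wT e → CommonPred (T q) (wT (f ∘ e)) (f ∘ e)) where
  open Lemma q A U f w wT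
  open Tree q
  open InC A∈𝒞 using (descTree)
  module F = IsIsoRel f-iso
  module ArcsA = Arcs A
  module ArcsT = Arcs (T q)

  no-2-cycle-belowA : ∀ a → ArcsA.NoTwoCycleBelow a
  no-2-cycle-belowA a x y a→x a→y x→y y→x with descTree a
  ... | φ , φ-iso = no-2-cycle (edge→ x y a→x a→y x→y) (edge→ y x a→y a→x y→x)
    where
    edge→ : ∀ x y → Desc A a x → Desc A a y → Edge A x y → Edge (T q) (φ x) (φ y)
    edge→ x y a→x a→y = IsIsoRel.edge→ φ-iso x y (φ x) (φ y) a→x a→y refl refl

  Desc-stepA : ArcsA.DescStep
  Desc-stepA = ArcsA.Desc-∷ʳ (no-2-cycle-belowA _)

  Desc-transA : ∀ {a x y} → Desc A a x → Desc A x y → Desc A a y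
  Desc-transA = ArcsA.Desc-trans Desc-stepA

  Desc-transT : ∀ {a x y} → Desc (T q) a x → Desc (T q) x y → Desc (T q) a y
  Desc-transT = ArcsT.Desc-trans Desc-step

  no-edge-to-ancestorA : ∀ {a x} → Desc A a x → Edge A x a → ⊥
  no-edge-to-ancestorA {a} {x} a→x x→a with descTree a
  ... | φ , φ-iso with Desc-transport φ-iso Desc-transA Desc-step (ArcsA.Desc-refl a) refl a→x
  ...   | _ , refl , φa→φx = no-edge-to-ancestor φa→φx
          (IsIsoRel.edge→ φ-iso x a (φ x) (φ a) a→x (ArcsA.Desc-refl a) refl refl x→a)

  i₀ : Fin q
  i₀ = fromℕ< (ℕₚ.≤-trans (s≤s z≤n) 2≤q)

  descU : Subset A
  descU = DescSet A U

  descV : Subset (T q)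
  descV = DescSet (T q) V

  descU-closed : ∀ {s t} → descU s → Desc A s t → descU t
  descU-closed (u , Uu , u→s) s→t = u , Uu , Desc-transA u→s s→t

  descV-closed : ∀ {s t} → descV s → Desc (T q) s t → descV t
  descV-closed (v , Vv , v→s) s→t = v , Vv , Desc-transT v→s s→t

  U⊆descU : ∀ {u} → U u → descU u
  U⊆descU {u} Uu = u , Uu , ArcsA.Desc-refl u

  V⊆descV : ∀ {v} → V v → descV v
  V⊆descV {v} Vv = v , Vv , ArcsT.Desc-refl v

  f-preserves-Desc : ∀ {s t} → descU s → Desc A s t → Desc (T q) (f s) (f t)
  f-preserves-Desc Us s→t with Desc-transport f-iso descU-closed Desc-step Us refl s→t
  ... | _ , refl , fs→ft = fs→ft

  f-reflects-Desc : ∀ {s t} → descU s → descU t → Desc (T q) (f s) (f t) → Desc A s t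
  f-reflects-Desc {s} {t} Us Ut fs→ft
    with Desc-transport (IsIsoRel-inverse f-iso) descV-closed Desc-stepA
           (F.into s (f s) Us refl) (Us , refl) fs→ft
  ... | t' , (Ut' , ft'≡ft) , s→t' = subst (Desc A s) (F.injective t' t (f t) Ut' Ut ft'≡ft refl) s→t'

  -- Independence of U only refutes u' ≢ a; the equality f a ≡ v is then recovered by
  -- stability of decidable equality on T.
  f-maps-U-into-V : ∀ {a} → U a → V (f a)
  f-maps-U-into-V {a} Ua with F.into a (f a) (U⊆descU Ua) refl
  ... | v , Vv , v→fa = subst V (sym (decidable-stable (Listₚ.≡-dec Finₚ._≟_ (f a) v) ¬¬fa≡v)) Vv
    where
    ¬¬fa≡v : ¬ ¬ (f a ≡ v)
    ¬¬fa≡v fa≢v with F.surjective v (V⊆descV Vv)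
    ... | a' , (u' , Uu' , u'→a') , fa'≡v =
      U-ind u' a Uu' Ua u'≢a a (Desc-transA u'→a' a'→a , ArcsA.Desc-refl a)
      where
      a'→a : Desc A a' a
      a'→a = f-reflects-Desc (u' , Uu' , u'→a') (U⊆descU Ua)
               (subst (λ z → Desc (T q) z (f a)) (sym fa'≡v) v→fa)
      u'≢a : u' ≢ a
      u'≢a refl = fa≢v (sym (Desc-antisym
        (subst (Desc (T q) (f a)) fa'≡v (f-preserves-Desc (U⊆descU Ua) u'→a')) v→fa))

  f-injective-on-U : ∀ {a b} → U a → U b → f a ≡ f b → a ≡ b
  f-injective-on-U {a} {b} Ua Ub fa≡fb = F.injective a b (f b) (U⊆descU Ua) (U⊆descU Ub) fa≡fb refl

  InQ-injective : ∀ {e} → InQ e → Injective _≡_ _≡_ e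
  InQ-injective = proj₁

  InQ-⊆U : ∀ {e} → InQ e → ∀ i → U (e i)
  InQ-⊆U = proj₁ ∘ proj₂

  wTf : (Fin q → Carrier A) → List (Fin q)
  wTf e = wT (f ∘ e)

  children-of-w : ∀ {e} → InQ e → ∀ v → Edge A (w e) v → ∃[ i ] (e i ≡ v)
  children-of-w {e} iq v we→v with descTree (w e)
  ... | φ , φ-iso with children-of-common-pred (φ (w e)) (φ ∘ e) (λ i → φ-edge (w-pred e iq i))
                         (InQ-injective iq ∘ φ-injective) (φ v) (φ-edge we→v)
    where
    φ-edge : ∀ {v} → Edge A (w e) v → Edge (T q) (φ (w e)) (φ v)
    φ-edge {v} we→v = IsIsoRel.edge→ φ-iso (w e) v _ _
                        (ArcsA.Desc-refl _) (ArcsA.Edge⇒Desc we→v) refl refl we→v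
    φ-injective : ∀ {i j} → φ (e i) ≡ φ (e j) → e i ≡ e j
    φ-injective {i} {j} eq = IsIsoRel.injective φ-iso (e i) (e j) (φ (e j))
      (ArcsA.Edge⇒Desc (w-pred e iq i)) (ArcsA.Edge⇒Desc (w-pred e iq j)) eq refl
  ...   | i , φei≡φv = i , IsIsoRel.injective φ-iso (e i) v (φ v)
            (ArcsA.Edge⇒Desc (w-pred e iq i)) (ArcsA.Edge⇒Desc we→v) φei≡φv refl

  children-of-wTf : ∀ {e} → InQ e → ∀ y → Edge (T q) (wTf e) y → ∃[ i ] (f (e i) ≡ y)
  children-of-wTf {e} iq = children-of-common-pred (wTf e) (f ∘ e) (wT-pred e iq)
    (InQ-injective iq ∘ f-injective-on-U (InQ-⊆U iq _) (InQ-⊆U iq _))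

  wTf-shared : ∀ {e e' i j} → InQ e → InQ e' → f (e i) ≡ f (e' j) → wTf e ≡ wTf e'
  wTf-shared {e} {e'} {i} iq iq' fei≡fe'j =
    Edge-parent-unique (wT-pred e iq i) (subst (Edge (T q) (wTf e')) (sym fei≡fe'j) (wT-pred e' iq' _))

  image-⊆ : ∀ {e e'} → InQ e → InQ e' → wTf e ≡ wTf e' → ∀ k → ∃[ k' ] (e' k' ≡ e k)
  image-⊆ {e} {e'} iq iq' wTfe≡wTfe' k
    with children-of-wTf iq' (f (e k)) (subst (λ z → Edge (T q) z (f (e k))) wTfe≡wTfe' (wT-pred e iq k))
  ... | k' , eq = k' , f-injective-on-U (InQ-⊆U iq' k') (InQ-⊆U iq k) eq

  w-shared : ∀ {e e' i j} → InQ e → InQ e' → e i ≡ e' j → w e ≡ w e'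
  w-shared {e} {e'} iq iq' ei≡e'j = w-image e e' iq iq' λ z →
      (λ { (k , refl) → image-⊆ iq iq' wTfe≡wTfe' k })
    , (λ { (k , refl) → image-⊆ iq' iq (sym wTfe≡wTfe') k })
    where
    wTfe≡wTfe' : wTf e ≡ wTf e'
    wTfe≡wTfe' = wTf-shared iq iq' (cong f ei≡e'j)

  module AscendA = Ascend A Desc-stepA no-edge-to-ancestorA InQ (λ e → e) w
                     (w-pred _) children-of-w w-shared i₀
  module AscendT = Ascend (T q) Desc-step no-edge-to-ancestor InQ (λ e → f ∘ e) wTf
                     (wT-pred _) children-of-wTf wTf-shared i₀

  U'-independent : Independent A U'
  U'-independent = AscendA.ascend-independent U-ind InQ-⊆U

  f∘InQ-⊆V : ∀ {e} → InQ e → ∀ i → V (f (e i))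
  f∘InQ-⊆V iq i = f-maps-U-into-V (InQ-⊆U iq i)

  V'-independent : Independent (T q) (V' V)
  V'-independent = AscendT.ascend-independent V-ind f∘InQ-⊆V

  U'∪I-independent : (I : Subset A) → (∀ x → I x → ¬ U x) → Independent A (U ∪ I) →
                     Independent A (U' ∪ I)
  U'∪I-independent I I∩U=∅ UI-ind =
    Independent-antitone U'∪I⊆ (AscendA.ascend-independent UI-ind (λ iq i → inj₁ (InQ-⊆U iq i)))
    where
    U'∪I⊆ : ∀ {x} → (U' ∪ I) x → AscendA.ascend (U ∪ I) x
    U'∪I⊆ (inj₁ (inj₁ (Ux , x-kept))) = inj₁ (inj₁ Ux , x-kept)
    U'∪I⊆ (inj₁ (inj₂ root))          = inj₂ root
    U'∪I⊆ {x} (inj₂ Ix)               =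
      inj₁ (inj₂ Ix , λ { (e , iq , i , refl) → I∩U=∅ x Ix (InQ-⊆U iq i) })

  descU' : Subset A
  descU' = DescSet A U'

  descV' : Subset (T q)
  descV' = DescSet (T q) (V' V)

  w∉descU : ∀ {e} → InQ e → ¬ descU (w e)
  w∉descU = AscendA.root∉descS U-ind InQ-⊆U

  wTf∉descV : ∀ {e} → InQ e → ¬ descV (wTf e)
  wTf∉descV = AscendT.root∉descS V-ind f∘InQ-⊆V

  w≡⇒wTf≡ : ∀ {e e'} → InQ e → InQ e' → w e ≡ w e' → wTf e ≡ wTf e'
  w≡⇒wTf≡ iq iq' we≡we' with AscendA.root≡⇒shared iq iq' we≡we'
  ... | _ , _ , ei≡e'j = wTf-shared iq iq' (cong f ei≡e'j)

  wTf≡⇒w≡ : ∀ {e e'} → InQ e → InQ e' → wTf e ≡ wTf e' → w e ≡ w e'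
  wTf≡⇒w≡ iq iq' wTfe≡wTfe' with AscendT.root≡⇒shared iq iq' wTfe≡wTfe'
  ... | i , j , fei≡fe'j = w-shared iq iq' (f-injective-on-U (InQ-⊆U iq i) (InQ-⊆U iq' j) fei≡fe'j)

  Fext-total : ∀ x → descU' x → ∃[ y ] Fext x y
  Fext-total x U'x with AscendA.descS-ascend U-ind InQ-⊆U U'x
  ... | inj₁ Ux              = f x , inj₁ (Ux , refl)
  ... | inj₂ (e , iq , we≡x) = wTf e , inj₂ (e , iq , we≡x , refl)

  Fext-into : ∀ x y → descU' x → Fext x y → descV' y
  Fext-into x _ _ (inj₂ (e , iq , _ , refl)) = wTf e , inj₂ (e , iq , refl) , ArcsT.Desc-refl _
  Fext-into x _ (a , inj₁ (Ua , a-kept) , a→x) (inj₁ (_ , refl)) =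
    f a , inj₁ (f-maps-U-into-V Ua , fa-kept) , f-preserves-Desc (U⊆descU Ua) a→x
    where
    fa-kept : ¬ (∃[ e ] (InQ e × ∃[ i ] (f (e i) ≡ f a)))
    fa-kept (e , iq , i , fei≡fa) = a-kept (e , iq , i , f-injective-on-U (InQ-⊆U iq i) Ua fei≡fa)
  Fext-into x _ (_ , inj₂ (e , iq , refl) , we→x) (inj₁ (Ux , refl)) with AscendA.Desc-root iq we→x
  ... | inj₁ refl       = ⊥-elim (w∉descU iq Ux)
  ... | inj₂ (i , ei→x) = wTf e , inj₂ (e , iq , refl) ,
    Desc-transT (ArcsT.Edge⇒Desc (wT-pred e iq i)) (f-preserves-Desc (U⊆descU (InQ-⊆U iq i)) ei→x)

  Fext-functional : ∀ x y y' → descU' x → Fext x y → Fext x y' → y ≡ y'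
  Fext-functional x y y' _ (inj₁ (_ , fx≡y)) (inj₁ (_ , fx≡y')) = trans (sym fx≡y) fx≡y'
  Fext-functional x y y' _ (inj₁ (Ux , _)) (inj₂ (e , iq , refl , _)) = ⊥-elim (w∉descU iq Ux)
  Fext-functional x y y' _ (inj₂ (e , iq , refl , _)) (inj₁ (Ux , _)) = ⊥-elim (w∉descU iq Ux)
  Fext-functional x y y' _ (inj₂ (e , iq , we≡x , refl)) (inj₂ (e' , iq' , we'≡x , refl)) =
    w≡⇒wTf≡ iq iq' (trans we≡x (sym we'≡x))

  Fext-injective : ∀ x x' y → descU' x → descU' x' → Fext x y → Fext x' y → x ≡ x'
  Fext-injective x x' y _ _ (inj₁ (Ux , fx≡y)) (inj₁ (Ux' , fx'≡y)) =
    F.injective x x' y Ux Ux' fx≡y fx'≡y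
  Fext-injective x x' y _ _ (inj₁ (Ux , refl)) (inj₂ (e , iq , _ , wTfe≡fx)) =
    ⊥-elim (wTf∉descV iq (subst descV (sym wTfe≡fx) (F.into x (f x) Ux refl)))
  Fext-injective x x' y _ _ (inj₂ (e , iq , _ , refl)) (inj₁ (Ux' , fx'≡wTfe)) =
    ⊥-elim (wTf∉descV iq (subst descV fx'≡wTfe (F.into x' (f x') Ux' refl)))
  Fext-injective x x' y _ _ (inj₂ (e , iq , refl , refl)) (inj₂ (e' , iq' , refl , wTfe'≡wTfe)) =
    wTf≡⇒w≡ iq iq' (sym wTfe'≡wTfe)

  Fext-surjective : ∀ y → descV' y → ∃[ x ] (descU' x × Fext x y)
  Fext-surjective y (v , inj₁ (Vv , v-kept) , v→y) with F.surjective y (v , Vv , v→y)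
  ... | x , (u , Uu , u→x) , fx≡y =
    x , (u , inj₁ (Uu , u-kept) , u→x) , inj₁ ((u , Uu , u→x) , fx≡y)
    where
    fu→y : Desc (T q) (f u) y
    fu→y = subst (Desc (T q) (f u)) fx≡y (f-preserves-Desc (U⊆descU Uu) u→x)
    u-kept : ¬ (∃[ e ] (InQ e × ∃[ i ] (e i ≡ u)))
    u-kept (e , iq , i , ei≡u) = V-ind (f u) v (f-maps-U-into-V Uu) Vv
      (λ fu≡v → v-kept (e , iq , i , trans (cong f ei≡u) fu≡v)) y (fu→y , v→y)
  Fext-surjective y (_ , inj₂ (e , iq , refl) , wTfe→y) with AscendT.Desc-root iq wTfe→y
  ... | inj₁ refl =
    w e , (w e , inj₂ (e , iq , refl) , ArcsA.Desc-refl _) , inj₂ (e , iq , refl , refl)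
  ... | inj₂ (i , fei→y) with F.surjective y (f (e i) , f∘InQ-⊆V iq i , fei→y)
  ...   | x , Ux , fx≡y = x , (w e , inj₂ (e , iq , refl) , we→x) , inj₁ (Ux , fx≡y)
    where
    we→x : Desc A (w e) x
    we→x = Desc-transA (ArcsA.Edge⇒Desc (w-pred e iq i))
             (f-reflects-Desc (U⊆descU (InQ-⊆U iq i)) Ux
               (subst (Desc (T q) (f (e i))) (sym fx≡y) fei→y))

  Fext-edge→ : ∀ x x' y y' → descU' x → descU' x' → Fext x y → Fext x' y' →
               Edge A x x' → Edge (T q) y y'
  Fext-edge→ x x' y y' _ _ (inj₁ (Ux , fx≡y)) (inj₁ (Ux' , fx'≡y')) =
    F.edge→ x x' y y' Ux Ux' fx≡y fx'≡y'
  Fext-edge→ x x' y y' _ _ (inj₁ (Ux , _)) (inj₂ (e' , iq' , refl , _)) x→x' =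
    ⊥-elim (w∉descU iq' (descU-closed Ux (ArcsA.Edge⇒Desc x→x')))
  Fext-edge→ x x' y y' _ _ (inj₂ (e , iq , refl , refl)) (inj₁ (_ , refl)) x→x'
    with children-of-w iq x' x→x'
  ... | i , refl = wT-pred e iq i
  Fext-edge→ x x' y y' _ _ (inj₂ (e , iq , refl , _)) (inj₂ (e' , iq' , refl , _)) x→x'
    with children-of-w iq (w e') x→x'
  ... | i , ei≡we' = ⊥-elim (w∉descU iq' (subst descU ei≡we' (U⊆descU (InQ-⊆U iq i))))

  Fext-edge← : ∀ x x' y y' → descU' x → descU' x' → Fext x y → Fext x' y' →
               Edge (T q) y y' → Edge A x x'
  Fext-edge← x x' y y' _ _ (inj₁ (Ux , fx≡y)) (inj₁ (Ux' , fx'≡y')) =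
    F.edge← x x' y y' Ux Ux' fx≡y fx'≡y'
  Fext-edge← x x' y y' _ _ (inj₁ (Ux , refl)) (inj₂ (e' , iq' , _ , refl)) fx→y' =
    ⊥-elim (wTf∉descV iq' (descV-closed (F.into x (f x) Ux refl) (ArcsT.Edge⇒Desc fx→y')))
  Fext-edge← x x' y y' _ _ (inj₂ (e , iq , refl , refl)) (inj₁ (Ux' , refl)) y→fx'
    with children-of-wTf iq (f x') y→fx'
  ... | i , fei≡fx' =
    subst (Edge A (w e)) (F.injective (e i) x' (f x') (U⊆descU (InQ-⊆U iq i)) Ux' fei≡fx' refl)
      (w-pred e iq i)
  Fext-edge← x x' y y' _ _ (inj₂ (e , iq , _ , refl)) (inj₂ (e' , iq' , _ , refl)) y→y'
    with children-of-wTf iq (wTf e') y→y'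
  ... | i , fei≡wTfe' = ⊥-elim (wTf∉descV iq' (subst descV fei≡wTfe' (V⊆descV (f∘InQ-⊆V iq i))))

  Fext-iso : IsIsoRel A (T q) descU' descV' Fext
  Fext-iso = record
    { total = Fext-total ; into = Fext-into ; functional = Fext-functional
    ; injective = Fext-injective ; surjective = Fext-surjective
    ; edge→ = Fext-edge→ ; edge← = Fext-edge← }

lemma3p2 : (q : ℕ) → 2 ≤ q → (A : Digraph) → InC q A →
    (U : Subset A) (V : Subset (T q)) →
    Independent A U → Independent (T q) V →
    (f : Carrier A → List (Fin q)) →
    IsIsoRel A (T q) (DescSet A U) (DescSet (T q) V) (Graph f) →
    (w : (Fin q → Carrier A) → Carrier A) →
    (wT : (Fin q → List (Fin q)) → List (Fin q)) →
    (∀ e → Lemma.InQ q A U f w wT e → CommonPred A (w e) e) →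
    (∀ e e' → Lemma.InQ q A U f w wT e → Lemma.InQ q A U f w wT e' →
      SameImage e e' → w e ≡ w e') →
    (∀ e → Lemma.InQ q A U f w wT e → CommonPred (T q) (wT (f ∘ e)) (f ∘ e)) →
    (Independent A (Lemma.U' q A U f w wT)
      × Independent (T q) (Lemma.V' q A U f w wT V)
      × IsIsoRel A (T q) (DescSet A (Lemma.U' q A U f w wT))
          (DescSet (T q) (Lemma.V' q A U f w wT V)) (Lemma.Fext q A U f w wT))
    × ((I : Subset A) → (∀ x → I x → ¬ U x) → Independent A (U ∪ I) →
        Independent A (Lemma.U' q A U f w wT ∪ I))
lemma3p2 q 2≤q A A∈𝒞 U V U-ind V-ind f f-iso w wT w-pred w-image wT-pred =
  (U'-independent , V'-independent , Fext-iso) , U'∪I-independent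
  where
  open Construction q 2≤q A A∈𝒞 U V U-ind V-ind f f-iso w wT w-pred w-image wT-pred
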